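{- Let $G$ be a finite group, $\Gamma_G$ its power graph and $M_G$ the set of maximal involutions of $G$. Then $\mathrm{rc}(\Gamma_G)\le \max\{|M_G|,3\}$.
   Context: For a finite group $G$ with identity $e$, the power graph $\Gamma_G$ is the undirected graph with vertex set $G$ in which two distinct elements are adjacent if one is a power of the other. An involution is an element of order $2$. An involution $x$ is maximal if the only cyclic subgroup of $G$ containing $x$ is $\langle x\rangle$; $M_G$ denotes the set of maximal involutions of $G$. For a connected graph $\Gamma$, an edge coloring $\zeta:E(\Gamma)\to\{1,\dots,k\}$ (adjacent edges may receive the same color) is a rainbow $k$-coloring if every pair of vertices is joined by a path whose edges have pairwise distinct colors; the rainbow connection number $\mathrm{rc}(\Gamma)$ is the minimum $k$ for which a rainbow $k$-coloring exists. -}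

module Defs where

open import Data.Nat using (ℕ; zero; suc; _≤_; _⊔_)
open import Data.Fin using (Fin)
open import Data.List using (List; []; _∷_; _++_; length)
open import Data.List.Relation.Unary.Unique.Propositional using (Unique)
open import Data.List.Membership.Propositional using (_∈_)
open import Data.Product using (Σ; ∃; ∃-syntax; _×_; _,_)
open import Data.Sum using (_⊎_)
open import Relation.Binary.PropositionalEquality using (_≡_; _≢_)
open import Relation.Nullary using (¬_)
open import Algebra.Structures using (IsGroup)

-- A finite group: a group structure on Fin order (every finite group is
-- isomorphic to such a group), with propositional equality.
record FiniteGroup : Set where
  field
    order   : ℕ
    _∙_     : Fin order → Fin order → Fin order
    ε       : Fin order
    _⁻¹     : Fin order → Fin order
    isGroup : IsGroup _≡_ _∙_ ε _⁻¹

module PowerGraph (G : FiniteGroup) where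
  open FiniteGroup G

  V : Set
  V = Fin order

  pow : V → ℕ → V
  pow x zero    = ε
  pow x (suc k) = x ∙ pow x k

  IsPowerOf : V → V → Set
  IsPowerOf x y = ∃[ k ] (x ≡ pow y k)

  Adj : V → V → Set
  Adj x y = (x ≢ y) × (IsPowerOf x y ⊎ IsPowerOf y x)

  IsInvolution : V → Set
  IsInvolution x = (x ≢ ε) × (x ∙ x ≡ ε)

  -- maximal involution: the only cyclic subgroup containing x is ⟨x⟩,
  -- i.e. whenever x ∈ ⟨y⟩ we have ⟨y⟩ = ⟨x⟩ (equivalently y ∈ ⟨x⟩)
  IsMaximalInvolution : V → Set
  IsMaximalInvolution x =
    IsInvolution x × (∀ y → IsPowerOf x y → IsPowerOf y x)

  data Path (u : V) : V → Set where
    here : Path u u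
    step : ∀ {v w} → Path u v → Adj v w → Path u w

  -- vertices of a path (listed from the end back to the start)
  vertices : ∀ {u v} → Path u v → List V
  vertices {u} here = u ∷ []
  vertices {v = w} (step p _) = w ∷ vertices p

  -- an edge colouring with k colours: a symmetric colour assignment on
  -- unordered pairs (only its values on edges matter)
  record EdgeColoring (k : ℕ) : Set where
    field
      col  : V → V → Fin k
      symm : ∀ x y → col x y ≡ col y x

  edgeColors : ∀ {k} → EdgeColoring k → ∀ {u v} → Path u v → List (Fin k)
  edgeColors c here = []
  edgeColors c (step {v} {w} p _) = EdgeColoring.col c v w ∷ edgeColors c p

  IsRainbow : ∀ {k} → EdgeColoring k → Set
  IsRainbow c = ∀ u v → Σ (Path u v) λ p →
    Unique (vertices p) × Unique (edgeColors c p)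

  RcAtMost : ℕ → Set
  RcAtMost m = ∃[ k ] (k ≤ m × Σ (EdgeColoring k) IsRainbow)

  -- L enumerates M_G without repetition, so |M_G| = length L
  EnumeratesMaxInvolutions : List V → Set
  EnumeratesMaxInvolutions L = Unique L × (∀ x → x ∈ L → IsMaximalInvolution x)
                                        × (∀ x → IsMaximalInvolution x → x ∈ L)

module Submission where

-- Label each vertex x by its position in the enumeration L of M_G if x ∈ M_G,
-- and otherwise by a bit, chosen so that x and x⁻¹ get different bits when
-- x⁻¹ ≠ x.  Edges through the identity e get the label of the other endpoint,
-- all other edges get colour 2.  Vertices u, v ≠ e with different labels are
-- joined by the rainbow path u – e – v.  If the labels agree, one of them,
-- say v, is outside M_G (labels are injective on M_G), so v ∈ ⟨z⟩ = ⟨z⁻¹⟩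
-- for some z of order > 2; one of z, z⁻¹ is a neighbour w of v with a label
-- different from v's, and u – e – w – v is rainbow (colours label u, label w, 2).

open import Defs
open import Data.Nat using (_⊔_)
open import Data.List using (List; length)
open import Data.Fin using (Fin)

open import Level using (0ℓ)
open import Data.Bool using (Bool; true; false; if_then_else_; _∨_)
open import Data.Bool.Properties using (∨-comm)
open import Data.Nat using (ℕ; zero; suc; _+_; _*_; _<_; _≤_; s≤s; z≤n)
import Data.Nat.Properties as ℕ
open import Data.Fin using (toℕ; fromℕ<; _≟_; _<?_)
import Data.Fin.Properties as Fin
open import Data.List using (lookup; []; _∷_)
open import Data.List.Relation.Unary.AllPairs using ([]; _∷_)
open import Data.List.Relation.Unary.All using ([]; _∷_)
open import Data.List.Relation.Unary.Any using (index)
open import Data.List.Relation.Unary.Any.Properties using (lookup-index)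
open import Data.List.Relation.Unary.Unique.Propositional using (Unique)
open import Data.List.Membership.Propositional using (_∈_; _∉_)
import Data.List.Membership.DecPropositional as DecMembership
open import Data.Product using (Σ; ∃-syntax; _×_; _,_; proj₁; proj₂)
open import Data.Sum using (_⊎_; inj₁; inj₂)
open import Data.Empty using (⊥-elim)
open import Relation.Nullary using (¬_; Dec; yes; no; does)
open import Relation.Nullary.Decidable using (dec-true; dec-false; _→-dec_)
open import Relation.Binary.PropositionalEquality
open import Algebra.Bundles using (Group)
open import Algebra.Structures using (IsGroup)

module Powers (G : FiniteGroup) where
  open FiniteGroup G
  open PowerGraph G
  open IsGroup isGroup using (assoc; identityˡ; identityʳ)

  group : Group 0ℓ 0ℓ
  group = record { Carrier = V ; _≈_ = _≡_ ; _∙_ = _∙_ ; ε = ε ; _⁻¹ = _⁻¹ ; isGroup = isGroup }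

  open import Algebra.Properties.Group group
    using (∙-cancelˡ; inverseʳ-unique; ⁻¹-involutive; ε⁻¹≈ε)
    public

  pow-+ : ∀ x a b → pow x (a + b) ≡ pow x a ∙ pow x b
  pow-+ x zero    b = sym (identityˡ (pow x b))
  pow-+ x (suc a) b = trans (cong (x ∙_) (pow-+ x a b)) (sym (assoc x (pow x a) (pow x b)))

  pow-pow : ∀ x a b → pow (pow x b) a ≡ pow x (a * b)
  pow-pow x zero    b = refl
  pow-pow x (suc a) b = trans (cong (pow x b ∙_) (pow-pow x a b)) (sym (pow-+ x b (a * b)))

  isPowerOf-trans : ∀ {x y z} → IsPowerOf x y → IsPowerOf y z → IsPowerOf x z
  isPowerOf-trans {z = z} (a , refl) (b , refl) = a * b , pow-pow z a b

  -- Every element has finite order: among x⁰, …, xⁿ (n = |G|) two powers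
  -- coincide, and cancelling gives x^(d+1) = e.
  finiteOrder : ∀ x → ∃[ d ] (pow x (suc d) ≡ ε)
  finiteOrder x with Fin.pigeonhole (ℕ.n<1+n order) (λ (i : Fin (suc order)) → pow x (toℕ i))
  ... | i , j , i<j , xⁱ≡xʲ = collision (toℕ i) (toℕ j) i<j xⁱ≡xʲ
    where
    collision : ∀ i j → i < j → pow x i ≡ pow x j → ∃[ d ] (pow x (suc d) ≡ ε)
    collision zero    (suc d) _         e≡xʲ = d , sym e≡xʲ
    collision (suc i) (suc j) (s≤s i<j) eq   = collision i j i<j (∙-cancelˡ x _ _ eq)

  inverse-isPower : ∀ x → IsPowerOf (x ⁻¹) x
  inverse-isPower x with finiteOrder x
  ... | d , x^[d+1]≡ε = d , sym (inverseʳ-unique x (pow x d) x^[d+1]≡ε)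

  isPowerOf-inverse : ∀ {v z} → IsPowerOf v z → IsPowerOf v (z ⁻¹)
  isPowerOf-inverse {z = z} v∈⟨z⟩ = isPowerOf-trans v∈⟨z⟩ z∈⟨z⁻¹⟩
    where
    z∈⟨z⁻¹⟩ : IsPowerOf z (z ⁻¹)
    z∈⟨z⁻¹⟩ = subst (λ t → IsPowerOf t (z ⁻¹)) (⁻¹-involutive z) (inverse-isPower (z ⁻¹))

  boundedExponent : ∀ x d → pow x (suc d) ≡ ε → ∀ k → ∃[ j ] (j < suc d × pow x k ≡ pow x j)
  boundedExponent x d x^[d+1]≡ε zero = zero , s≤s z≤n , refl
  boundedExponent x d x^[d+1]≡ε (suc k) with boundedExponent x d x^[d+1]≡ε k
  ... | j , j≤d , xᵏ≡xʲ with suc j ℕ.<? suc d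
  ...   | yes j+1≤d = suc j , j+1≤d , cong (x ∙_) xᵏ≡xʲ
  ...   | no  j+1≰d = zero , s≤s z≤n , trans (cong (x ∙_) xᵏ≡xʲ) x^[j+1]≡ε
    where
    x^[j+1]≡ε : pow x (suc j) ≡ ε
    x^[j+1]≡ε = trans (cong (pow x) (ℕ.≤-antisym j≤d (ℕ.≮⇒≥ j+1≰d))) x^[d+1]≡ε

  isPowerOf? : ∀ x y → Dec (IsPowerOf x y)
  isPowerOf? x y with finiteOrder y
  ... | d , y^[d+1]≡ε with Fin.any? (λ (j : Fin (suc d)) → x ≟ pow y (toℕ j))
  ...   | yes (j , x≡yʲ) = yes (toℕ j , x≡yʲ)
  ...   | no  noSmallExponent = no λ where
          (k , x≡yᵏ) → let (j , j≤d , yᵏ≡yʲ) = boundedExponent y d y^[d+1]≡ε k in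
            noSmallExponent (fromℕ< j≤d ,
              trans x≡yᵏ (trans yᵏ≡yʲ (cong (pow y) (sym (Fin.toℕ-fromℕ< j≤d)))))

  selfInverse⇒square≡ε : ∀ x → x ⁻¹ ≡ x → x ∙ x ≡ ε
  selfInverse⇒square≡ε x x⁻¹≡x = trans (cong (x ∙_) (sym x⁻¹≡x)) (IsGroup.inverseʳ isGroup x)

  square≡ε⇒selfInverse : ∀ x → x ∙ x ≡ ε → x ⁻¹ ≡ x
  square≡ε⇒selfInverse x x²≡ε = sym (inverseʳ-unique x x x²≡ε)

  selfInverse-powers : ∀ x → x ⁻¹ ≡ x → ∀ k → pow x k ≡ ε ⊎ pow x k ≡ x
  selfInverse-powers x x⁻¹≡x zero = inj₁ refl
  selfInverse-powers x x⁻¹≡x (suc k) with selfInverse-powers x x⁻¹≡x k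
  ... | inj₁ xᵏ≡ε = inj₂ (trans (cong (x ∙_) xᵏ≡ε) (identityʳ x))
  ... | inj₂ xᵏ≡x = inj₁ (trans (cong (x ∙_) xᵏ≡x) (selfInverse⇒square≡ε x x⁻¹≡x))

  notSelfInverse-inverse : ∀ z → z ⁻¹ ≢ z → z ⁻¹ ⁻¹ ≢ z ⁻¹
  notSelfInverse-inverse z z⁻¹≢z eq = z⁻¹≢z (trans (sym eq) (⁻¹-involutive z))

  notSelfInverse⇒≢ε : ∀ z → z ⁻¹ ≢ z → z ≢ ε
  notSelfInverse⇒≢ε z z⁻¹≢z refl = z⁻¹≢z ε⁻¹≈ε

  identity-adjacent : ∀ v → v ≢ ε → Adj ε v
  identity-adjacent v v≢ε = ≢-sym v≢ε , inj₁ (zero , refl)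

  nonMaximal⇒escape : ∀ v → IsInvolution v → ¬ IsMaximalInvolution v →
    ∃[ y ] (IsPowerOf v y × ¬ IsPowerOf y v)
  nonMaximal⇒escape v inv notMaximal with
    Fin.¬∀⟶∃¬ order (λ y → IsPowerOf v y → IsPowerOf y v)
      (λ y → isPowerOf? v y →-dec isPowerOf? y v) (λ maximal → notMaximal (inv , maximal))
  ... | y , notBack with isPowerOf? v y
  ...   | yes v∈⟨y⟩ = y , v∈⟨y⟩ , λ y∈⟨v⟩ → notBack (λ _ → y∈⟨v⟩)
  ...   | no  v∉⟨y⟩ = ⊥-elim (notBack (λ v∈⟨y⟩ → ⊥-elim (v∉⟨y⟩ v∈⟨y⟩)))

  nonMaximal⇒covered : ∀ v → v ≢ ε → ¬ IsMaximalInvolution v →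
    ∃[ z ] (z ⁻¹ ≢ z × IsPowerOf v z)
  nonMaximal⇒covered v v≢ε notMaximal with v ⁻¹ ≟ v
  ... | no  v⁻¹≢v = v , v⁻¹≢v , 1 , sym (identityʳ v)
  ... | yes v⁻¹≡v with nonMaximal⇒escape v (v≢ε , selfInverse⇒square≡ε v v⁻¹≡v) notMaximal
  ...   | y , (k , v≡yᵏ) , y∉⟨v⟩ = y , y⁻¹≢y , k , v≡yᵏ
    where
    -- if y had order ≤ 2, then v = yᵏ ∈ {e, y}, contradicting v ≠ e and y ∉ ⟨v⟩
    y⁻¹≢y : y ⁻¹ ≢ y
    y⁻¹≢y y⁻¹≡y with selfInverse-powers y y⁻¹≡y k
    ... | inj₁ yᵏ≡ε = v≢ε (trans v≡yᵏ yᵏ≡ε)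
    ... | inj₂ yᵏ≡y = y∉⟨v⟩ (1 , trans (sym (trans v≡yᵏ yᵏ≡y)) (sym (identityʳ v)))

module ShortRainbowPaths (G : FiniteGroup) {k : ℕ} (c : PowerGraph.EdgeColoring G k) where
  open PowerGraph G
  open EdgeColoring c

  RainbowPath : V → V → Set
  RainbowPath u v = Σ (Path u v) λ p → Unique (vertices p) × Unique (edgeColors c p)

  trivialPath : ∀ u → RainbowPath u u
  trivialPath u = here , [] ∷ [] , []

  edgePath : ∀ {u v} → Adj u v → RainbowPath u v
  edgePath u~v@(u≢v , _) = step here u~v , (≢-sym u≢v ∷ []) ∷ [] ∷ [] , [] ∷ []

  path₂ : ∀ {u a v} → Adj u a → Adj a v → u ≢ v → col u a ≢ col a v → RainbowPath u v
  path₂ u~a@(u≢a , _) a~v@(a≢v , _) u≢v colours =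
    step (step here u~a) a~v ,
    (≢-sym a≢v ∷ ≢-sym u≢v ∷ []) ∷ (≢-sym u≢a ∷ []) ∷ [] ∷ [] ,
    (≢-sym colours ∷ []) ∷ [] ∷ []

  path₃ : ∀ {u a b v} → Adj u a → Adj a b → Adj b v → u ≢ b → u ≢ v → a ≢ v →
    col u a ≢ col a b → col u a ≢ col b v → col a b ≢ col b v → RainbowPath u v
  path₃ u~a@(u≢a , _) a~b@(a≢b , _) b~v@(b≢v , _) u≢b u≢v a≢v ua≢ab ua≢bv ab≢bv =
    step (step (step here u~a) a~b) b~v ,
    (≢-sym b≢v ∷ ≢-sym a≢v ∷ ≢-sym u≢v ∷ []) ∷ (≢-sym a≢b ∷ ≢-sym u≢b ∷ []) ∷
      (≢-sym u≢a ∷ []) ∷ [] ∷ [] ,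
    (≢-sym ab≢bv ∷ ≢-sym ua≢bv ∷ []) ∷ (≢-sym ua≢ab ∷ []) ∷ [] ∷ []

  Adj-sym : ∀ {u v} → Adj u v → Adj v u
  Adj-sym (u≢v , inj₁ u∈⟨v⟩) = ≢-sym u≢v , inj₂ u∈⟨v⟩
  Adj-sym (u≢v , inj₂ v∈⟨u⟩) = ≢-sym u≢v , inj₁ v∈⟨u⟩

module NumericColouring (G : FiniteGroup) {k : ℕ} (colour : PowerGraph.V G → PowerGraph.V G → ℕ)
    (colour-sym : ∀ x y → colour x y ≡ colour y x) (colour<k : ∀ x y → colour x y < k) where
  open PowerGraph G

  coloring : EdgeColoring k
  coloring = record
    { col  = λ x y → fromℕ< (colour<k x y)
    ; symm = λ x y → Fin.fromℕ<-cong _ _ (colour-sym x y) (colour<k x y) (colour<k y x)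
    }

  distinctColours : ∀ {a b c d m n} → colour a b ≡ m → colour c d ≡ n → m ≢ n →
    EdgeColoring.col coloring a b ≢ EdgeColoring.col coloring c d
  distinctColours {a} {b} {c} {d} refl refl m≢n same =
    m≢n (Fin.fromℕ<-injective _ _ (colour<k a b) (colour<k c d) same)

module MaximalInvolutionColouring (G : FiniteGroup) (L : List (Fin (FiniteGroup.order G)))
    (enumL : PowerGraph.EnumeratesMaxInvolutions G L) where
  open FiniteGroup G
  open PowerGraph G
  open Powers G
  open DecMembership (_≟_ {n = order}) using (_∈?_)

  k : ℕ
  k = length L ⊔ 3

  listed⇒maximal : ∀ x → x ∈ L → IsMaximalInvolution x
  listed⇒maximal = proj₁ (proj₂ enumL)

  maximal⇒listed : ∀ x → IsMaximalInvolution x → x ∈ L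
  maximal⇒listed = proj₂ (proj₂ enumL)

  listed⇒selfInverse : ∀ x → x ∈ L → x ⁻¹ ≡ x
  listed⇒selfInverse x x∈L with listed⇒maximal x x∈L
  ... | (_ , x²≡ε) , _ = square≡ε⇒selfInverse x x²≡ε

  notSelfInverse⇒unlisted : ∀ x → x ⁻¹ ≢ x → x ∉ L
  notSelfInverse⇒unlisted x x⁻¹≢x x∈L = x⁻¹≢x (listed⇒selfInverse x x∈L)

  unlisted⇒notMaximal : ∀ x → x ∉ L → ¬ IsMaximalInvolution x
  unlisted⇒notMaximal x x∉L maximal = x∉L (maximal⇒listed x maximal)

  orientation : V → V → ℕ
  orientation x y with x <? y
  ... | yes _ = 0
  ... | no  _ = 1

  orientation≤1 : ∀ x y → orientation x y ≤ 1
  orientation≤1 x y with x <? y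
  ... | yes _ = z≤n
  ... | no  _ = s≤s z≤n

  orientation-antisym : ∀ x y → x ≢ y → orientation x y ≢ orientation y x
  orientation-antisym x y x≢y with x <? y | y <? x
  ... | yes x<y | yes y<x = λ _ → Fin.<-asym x<y y<x
  ... | yes _   | no  _   = λ ()
  ... | no  _   | yes _   = λ ()
  ... | no  x≮y | no  y≮x = λ _ → x≢y (Fin.≤-antisym (ℕ.≮⇒≥ y≮x) (ℕ.≮⇒≥ x≮y))

  unlistedLabel : V → ℕ
  unlistedLabel x with x ⁻¹ ≟ x
  ... | yes _ = 0
  ... | no  _ = orientation x (x ⁻¹)

  unlistedLabel≤1 : ∀ x → unlistedLabel x ≤ 1
  unlistedLabel≤1 x with x ⁻¹ ≟ x
  ... | yes _ = z≤n
  ... | no  _ = orientation≤1 x (x ⁻¹)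

  unlistedLabel-inverse : ∀ x → x ⁻¹ ≢ x → unlistedLabel x ≢ unlistedLabel (x ⁻¹)
  unlistedLabel-inverse x x⁻¹≢x with x ⁻¹ ≟ x | x ⁻¹ ⁻¹ ≟ x ⁻¹
  ... | yes x⁻¹≡x | _          = ⊥-elim (x⁻¹≢x x⁻¹≡x)
  ... | no  _     | yes x⁻²≡x⁻¹ = ⊥-elim (notSelfInverse-inverse x x⁻¹≢x x⁻²≡x⁻¹)
  ... | no  _     | no  _      =
    subst (λ t → orientation x (x ⁻¹) ≢ orientation (x ⁻¹) t) (sym (⁻¹-involutive x))
      (orientation-antisym x (x ⁻¹) (≢-sym x⁻¹≢x))

  label : V → ℕ
  label x with x ∈? L
  ... | yes x∈L = toℕ (index x∈L)
  ... | no  _   = unlistedLabel x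

  label-unlisted : ∀ x → x ∉ L → label x ≡ unlistedLabel x
  label-unlisted x x∉L with x ∈? L
  ... | yes x∈L = ⊥-elim (x∉L x∈L)
  ... | no  _   = refl

  unlisted-label≤1 : ∀ x → x ∉ L → label x ≤ 1
  unlisted-label≤1 x x∉L = subst (_≤ 1) (sym (label-unlisted x x∉L)) (unlistedLabel≤1 x)

  label-injective-on-L : ∀ x y → x ∈ L → y ∈ L → label x ≡ label y → x ≡ y
  label-injective-on-L x y x∈L y∈L same with x ∈? L | y ∈? L
  ... | no  x∉L | _       = ⊥-elim (x∉L x∈L)
  ... | yes _   | no  y∉L = ⊥-elim (y∉L y∈L)
  ... | yes i   | yes j   = begin
    x                 ≡⟨ lookup-index i ⟩
    lookup L (index i) ≡⟨ cong (lookup L) (Fin.toℕ-injective same) ⟩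
    lookup L (index j) ≡⟨ sym (lookup-index j) ⟩
    y                 ∎
    where open ≡-Reasoning

  label-inverse : ∀ x → x ⁻¹ ≢ x → label x ≢ label (x ⁻¹)
  label-inverse x x⁻¹≢x =
    subst₂ _≢_ (sym (label-unlisted x (notSelfInverse⇒unlisted x x⁻¹≢x)))
      (sym (label-unlisted (x ⁻¹) (notSelfInverse⇒unlisted (x ⁻¹) (notSelfInverse-inverse x x⁻¹≢x))))
      (unlistedLabel-inverse x x⁻¹≢x)

  label-ε : label ε ≡ 0
  label-ε = trans (label-unlisted ε ε∉L) unlistedLabel-ε
    where
    ε∉L : ε ∉ L
    ε∉L ε∈L with listed⇒maximal ε ε∈L
    ... | (ε≢ε , _) , _ = ε≢ε refl
    unlistedLabel-ε : unlistedLabel ε ≡ 0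
    unlistedLabel-ε with ε ⁻¹ ≟ ε
    ... | yes _   = refl
    ... | no  ε⁻¹≢ε = ⊥-elim (ε⁻¹≢ε ε⁻¹≈ε)

  label<k : ∀ x → label x < k
  label<k x with x ∈? L
  ... | yes x∈L = ℕ.<-≤-trans (Fin.toℕ<n (index x∈L)) (ℕ.m≤m⊔n (length L) 3)
  ... | no  _   = ℕ.<-≤-trans (s≤s (ℕ.≤-trans (unlistedLabel≤1 x) (s≤s z≤n))) (ℕ.m≤n⊔m (length L) 3)

  coveringNeighbour : ∀ v w → w ⁻¹ ≢ w → IsPowerOf v w → label w ≢ label v →
    w ≢ ε × w ∉ L × Adj w v × label w ≢ label v
  coveringNeighbour v w w⁻¹≢w v∈⟨w⟩ differ =
    notSelfInverse⇒≢ε w w⁻¹≢w , notSelfInverse⇒unlisted w w⁻¹≢w ,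
    ((λ w≡v → differ (cong label w≡v)) , inj₂ v∈⟨w⟩) , differ

  -- A vertex v ∉ L, v ≠ e, has a neighbour w ∉ L, w ≠ e, with a different
  -- label: v ∈ ⟨z⟩ = ⟨z⁻¹⟩ with z⁻¹ ≠ z, and z, z⁻¹ have different labels.
  partner : ∀ v → v ≢ ε → v ∉ L → ∃[ w ] (w ≢ ε × w ∉ L × Adj w v × label w ≢ label v)
  partner v v≢ε v∉L with nonMaximal⇒covered v v≢ε (unlisted⇒notMaximal v v∉L)
  ... | z , z⁻¹≢z , v∈⟨z⟩ with label z ℕ.≟ label v
  ...   | no  differ = z , coveringNeighbour v z z⁻¹≢z v∈⟨z⟩ differ
  ...   | yes same   = z ⁻¹ , coveringNeighbour v (z ⁻¹) (notSelfInverse-inverse z z⁻¹≢z)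
                         (isPowerOf-inverse v∈⟨z⟩)
                         (λ same⁻¹ → label-inverse z z⁻¹≢z (trans same (sym same⁻¹)))

  isε : V → Bool
  isε x = does (x ≟ ε)

  -- Edges through e carry the label of the other endpoint (label e = 0);
  -- all other edges carry colour 2.
  colour : V → V → ℕ
  colour x y = if isε x ∨ isε y then label x ⊔ label y else 2

  colour-sym : ∀ x y → colour x y ≡ colour y x
  colour-sym x y = cong₂ (λ b n → if b then n else 2) (∨-comm (isε x) (isε y)) (ℕ.⊔-comm (label x) (label y))

  colour<k : ∀ x y → colour x y < k
  colour<k x y with isε x ∨ isε y
  ... | true  = ℕ.⊔-lub (label<k x) (label<k y)
  ... | false = ℕ.<-≤-trans (s≤s (s≤s (s≤s z≤n))) (ℕ.m≤n⊔m (length L) 3)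

  colour-from-ε : ∀ y → colour ε y ≡ label y
  colour-from-ε y rewrite dec-true (ε ≟ ε) refl | label-ε = refl

  colour-to-ε : ∀ x → colour x ε ≡ label x
  colour-to-ε x = trans (colour-sym x ε) (colour-from-ε x)

  colour-inner : ∀ x y → x ≢ ε → y ≢ ε → colour x y ≡ 2
  colour-inner x y x≢ε y≢ε rewrite dec-false (x ≟ ε) x≢ε | dec-false (y ≟ ε) y≢ε = refl

  open NumericColouring G colour colour-sym colour<k using (coloring; distinctColours) public
  open ShortRainbowPaths G coloring

  ≤1⇒≢2 : ∀ {n} → n ≤ 1 → n ≢ 2
  ≤1⇒≢2 (s≤s ()) refl

  detourAtEnd : ∀ u v → u ≢ v → u ≢ ε → v ≢ ε → v ∉ L → label u ≡ label v → RainbowPath u v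
  detourAtEnd u v u≢v u≢ε v≢ε v∉L same with partner v v≢ε v∉L
  ... | w , w≢ε , w∉L , w~v , w≠v-label =
    path₃ (Adj-sym (identity-adjacent u u≢ε)) (identity-adjacent w w≢ε) w~v
      u≢w u≢v (≢-sym v≢ε)
      (distinctColours (colour-to-ε u) (colour-from-ε w) (λ eq → w≠v-label (trans (sym eq) same)))
      (distinctColours (colour-to-ε u) (colour-inner w v w≢ε v≢ε)
        (≤1⇒≢2 (subst (_≤ 1) (sym same) (unlisted-label≤1 v v∉L))))
      (distinctColours (colour-from-ε w) (colour-inner w v w≢ε v≢ε) (≤1⇒≢2 (unlisted-label≤1 w w∉L)))
    where
    u≢w : u ≢ w
    u≢w u≡w = w≠v-label (trans (cong label (sym u≡w)) same)

  detourAtStart : ∀ u v → u ≢ v → u ≢ ε → v ≢ ε → u ∉ L → label u ≡ label v → RainbowPath u v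
  detourAtStart u v u≢v u≢ε v≢ε u∉L same with partner u u≢ε u∉L
  ... | w , w≢ε , w∉L , w~u , w≠u-label =
    path₃ (Adj-sym w~u) (Adj-sym (identity-adjacent w w≢ε)) (identity-adjacent v v≢ε)
      u≢ε u≢v w≢v
      (distinctColours (colour-inner u w u≢ε w≢ε) (colour-to-ε w) (≢-sym (≤1⇒≢2 (unlisted-label≤1 w w∉L))))
      (distinctColours (colour-inner u w u≢ε w≢ε) (colour-from-ε v)
        (≢-sym (≤1⇒≢2 (subst (_≤ 1) same (unlisted-label≤1 u u∉L)))))
      (distinctColours (colour-to-ε w) (colour-from-ε v) (λ eq → w≠u-label (trans eq (sym same))))
    where
    w≢v : w ≢ v
    w≢v w≡v = w≠u-label (trans (cong label w≡v) (sym same))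

  rainbowBetween : ∀ u v → u ≢ v → u ≢ ε → v ≢ ε → RainbowPath u v
  rainbowBetween u v u≢v u≢ε v≢ε with label u ℕ.≟ label v
  ... | no differ =
    path₂ (Adj-sym (identity-adjacent u u≢ε)) (identity-adjacent v v≢ε) u≢v
      (distinctColours (colour-to-ε u) (colour-from-ε v) differ)
  ... | yes same = sameLabel (v ∈? L) (u ∈? L)
    where
    -- deciding membership by a helper keeps `label u ≡ label v` unabstracted
    sameLabel : Dec (v ∈ L) → Dec (u ∈ L) → RainbowPath u v
    sameLabel (no  v∉L) _         = detourAtEnd u v u≢v u≢ε v≢ε v∉L same
    sameLabel (yes _)   (no  u∉L) = detourAtStart u v u≢v u≢ε v≢ε u∉L same
    sameLabel (yes v∈L) (yes u∈L) = ⊥-elim (u≢v (label-injective-on-L u v u∈L v∈L same))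

  rainbow : IsRainbow coloring
  rainbow u v with u ≟ v | u ≟ ε | v ≟ ε
  ... | yes refl | _       | _        = trivialPath u
  ... | no  u≢v  | yes refl | _       = edgePath (identity-adjacent v (≢-sym u≢v))
  ... | no  u≢v  | no  _   | yes refl = edgePath (Adj-sym (identity-adjacent u u≢v))
  ... | no  u≢v  | no  u≢ε | no  v≢ε  = rainbowBetween u v u≢v u≢ε v≢ε

lemma2p3 : (G : FiniteGroup) → (L : List (Fin (FiniteGroup.order G))) →
    PowerGraph.EnumeratesMaxInvolutions G L →
    PowerGraph.RcAtMost G (length L ⊔ 3)
lemma2p3 G L enumL = length L ⊔ 3 , ℕ.≤-refl , coloring , rainbow
  where open MaximalInvolutionColouring G L enumL
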